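{- Let $\mathcal{C}$ be a set of $3$-dimensional subspaces of $\mathbb{F}_2^7$ such that every $2$-dimensional subspace of $\mathbb{F}_2^7$ is contained in exactly one member of $\mathcal{C}$ (a $2$-analogue of the Fano plane; necessarily $\#\mathcal{C}=381$). Let $S$ be any $4$-dimensional subspace of $\mathbb{F}_2^7$, and for $0\le i\le 3$ let $a_i=\#\{U\in\mathcal{C};\ \dim(U\cap S)=i\}$. Then $(a_0,a_1,a_2,a_3)=(128,224,28,1)$ if $S$ contains a member of $\mathcal{C}$, and $(a_0,a_1,a_2,a_3)=(136,210,35,0)$ if $S$ contains no member of $\mathcal{C}$.
   Context: The vector $(a_0,a_1,a_2,a_3)$ is called the intersection vector of $S$ with respect to $\mathcal{C}$. -}

module Defs where

open import Data.Bool using (Bool; true; false; _∧_; _xor_; if_then_else_)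
open import Data.Nat using (ℕ; zero; suc)
open import Data.Vec using (Vec; []; _∷_; zipWith; replicate)
open import Data.List using (List; []; _∷_)
open import Data.Product using (Σ; ∃; _×_; _,_)
open import Relation.Nullary using (¬_)
open import Relation.Binary.PropositionalEquality using (_≡_)

V : ℕ → Set
V n = Vec Bool n

zeroV : ∀ {n} → V n
zeroV = replicate _ false

_+V_ : ∀ {n} → V n → V n → V n
_+V_ = zipWith _xor_

SubsetV : ℕ → Set
SubsetV n = V n → Bool

comb : ∀ {n d} → Vec Bool d → Vec (V n) d → V n
comb [] [] = zeroV
comb (c ∷ cs) (b ∷ bs) = if c then b +V comb cs bs else comb cs bs

HasDim : ∀ {n} → SubsetV n → ℕ → Set
HasDim {n} U d =
  Σ (Vec (V n) d) λ b →
    (∀ c → comb c b ≡ zeroV → c ≡ replicate d false)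
    × (∀ v → U v ≡ true → ∃ λ c → comb c b ≡ v)
    × (∀ c → U (comb c b) ≡ true)

_⊆V_ : ∀ {n} → SubsetV n → SubsetV n → Set
U ⊆V W = ∀ v → U v ≡ true → W v ≡ true

_∩V_ : ∀ {n} → SubsetV n → SubsetV n → SubsetV n
(U ∩V W) v = U v ∧ W v

_≗V_ : ∀ {n} → SubsetV n → SubsetV n → Set
U ≗V W = ∀ v → U v ≡ W v

data CountP {A : Set} (P : A → Set) : List A → ℕ → Set where
  cnil  : CountP P [] zero
  cyes  : ∀ {x xs k} → P x → CountP P xs k → CountP P (x ∷ xs) (suc k)
  cno   : ∀ {x xs k} → ¬ P x → CountP P xs k → CountP P (x ∷ xs) k

-- Write m U = |U ∩ S| ∈ {1, 2, 4, 8} for U ∈ C. Two distinct nonzero vectors span a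
-- 2-dimensional subspace, so every ordered pair of them lies in exactly one member of C.
-- Counting the ordered pairs in S∖0 × S∖0, S∖0 × F₂⁷∖0 and F₂⁷∖0 × F₂⁷∖0 member by member gives
--   Σ (m − 1)(m − 2) = 15 · 14,   Σ 6 (m − 1) = 15 · 126,   Σ 42 = 127 · 126,
-- three linear equations in a₀, …, a₃. Moreover a₃ ≤ 1: two members of C inside S have
-- index 2 in S, hence meet in at least 4 points and share a 2-dimensional subspace.
-- So a₃ is 1 or 0 according as S contains a member of C, and the equations give the rest.

module Submission where

open import Defs
open import Data.Bool using (Bool; true; false; _∧_; _∨_; _xor_; not; if_then_else_)
import Data.Bool.Properties as Bool
open import Data.Bool.Properties using (xor-assoc; xor-comm; xor-identityˡ; xor-identityʳ; xor-same; ∧-assoc)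
open import Data.Nat using (ℕ; zero; suc; _+_; _*_; _∸_; _^_; _≤_; _<_; z≤n; s≤s; s≤s⁻¹; _≟_; NonZero)
open import Data.Nat.Properties
open import Data.Vec using (Vec; []; _∷_; zipWith; replicate)
open import Data.Vec.Properties using (zipWith-assoc; zipWith-comm; zipWith-identityˡ; zipWith-identityʳ; ≡-dec)
import Data.Vec.Relation.Unary.All as VecAll
open VecAll using ([]; _∷_)
open import Data.List using (List; []; _∷_)
open import Data.List.Relation.Unary.All as All using (All; []; _∷_)
open import Data.List.Relation.Unary.Any using (Any; here; there)
open import Data.List.Relation.Unary.AllPairs as AllPairs using (AllPairs; []; _∷_)
open import Data.Product using (∃; ∃₂; _×_; _,_; proj₁; proj₂)
open import Data.Sum using (_⊎_; inj₁; inj₂)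
open import Data.Empty using (⊥; ⊥-elim)
open import Function using (_∘_; _$_)
open import Relation.Nullary using (¬_; Dec; yes; does; proof; contradiction)
open import Relation.Nullary.Decidable using (dec-true; map′)
open import Relation.Nullary.Reflects using (Reflects; ofʸ; ofⁿ)
open import Relation.Binary.PropositionalEquality
open import Relation.Binary.PropositionalEquality.Algebra using (isMagma)
open import Level using (0ℓ)
open import Algebra.Bundles using (CommutativeSemigroup)
import Algebra.Properties.CommutativeSemigroup as CommutativeSemigroupProperties
open CommutativeSemigroupProperties +-commutativeSemigroup using ()
  renaming (interchange to +-interchange; x∙yz≈y∙xz to +-exchange)

∧-true⁻ : ∀ {a b} → a ∧ b ≡ true → a ≡ true × b ≡ true
∧-true⁻ {true} b≡true = refl , b≡true

∧-true⁺ : ∀ {a b} → a ≡ true → b ≡ true → a ∧ b ≡ true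
∧-true⁺ refl refl = refl

not-true⁻ : ∀ {a} → not a ≡ true → a ≡ false
not-true⁻ {false} _ = refl

∨-true⁺ˡ : ∀ {a b} → a ≡ true → a ∨ b ≡ true
∨-true⁺ˡ refl = refl

∨-true⁺ʳ : ∀ a {b} → b ≡ true → a ∨ b ≡ true
∨-true⁺ʳ a refl = Bool.∨-zeroʳ a

∧-not≡false⇒ : ∀ {a b} → a ≡ true → a ∧ not b ≡ false → b ≡ true
∧-not≡false⇒ {b = true}  _    _  = refl
∧-not≡false⇒ {b = false} refl ()

∨-resolve : ∀ {a b} → a ≡ false → a ∨ b ≡ true → b ≡ true
∨-resolve refl b≡true = b≡true

Bool-ext : ∀ {a b} → (a ≡ true → b ≡ true) → (b ≡ true → a ≡ true) → a ≡ b
Bool-ext {true}          a⇒b _   = sym (a⇒b refl)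
Bool-ext {false} {true}  _   b⇒a = b⇒a refl
Bool-ext {false} {false} _   _   = refl

-- The vector space F₂ⁿ

+V-assoc : ∀ {n} (u v w : V n) → (u +V v) +V w ≡ u +V (v +V w)
+V-assoc = zipWith-assoc xor-assoc

+V-comm : ∀ {n} (u v : V n) → u +V v ≡ v +V u
+V-comm = zipWith-comm xor-comm

+V-identityˡ : ∀ {n} (v : V n) → zeroV +V v ≡ v
+V-identityˡ = zipWith-identityˡ xor-identityˡ

+V-identityʳ : ∀ {n} (v : V n) → v +V zeroV ≡ v
+V-identityʳ = zipWith-identityʳ xor-identityʳ

+V-self : ∀ {n} (v : V n) → v +V v ≡ zeroV
+V-self []      = refl
+V-self (a ∷ v) = cong₂ _∷_ (xor-same a) (+V-self v)

+V-cancelʳ : ∀ {n} (x y : V n) → (x +V y) +V y ≡ x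
+V-cancelʳ x y = trans (+V-assoc x y y) (trans (cong (x +V_) (+V-self y)) (+V-identityʳ x))

+V-cancelˡ : ∀ {n} (x y : V n) → y +V (y +V x) ≡ x
+V-cancelˡ x y = trans (sym (+V-assoc y y x)) (trans (cong (_+V x) (+V-self y)) (+V-identityˡ x))

+V≡zero⇒≡ : ∀ {n} {x y : V n} → x +V y ≡ zeroV → x ≡ y
+V≡zero⇒≡ {x = x} {y} e = trans (sym (+V-cancelʳ x y)) (trans (cong (_+V y) e) (+V-identityˡ y))

+V-commutativeSemigroup : ℕ → CommutativeSemigroup 0ℓ 0ℓ
+V-commutativeSemigroup n = record
  { Carrier = V n
  ; _≈_ = _≡_
  ; _∙_ = _+V_
  ; isCommutativeSemigroup = record
    { isSemigroup = record { isMagma = isMagma _+V_ ; assoc = +V-assoc }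
    ; comm = +V-comm
    }
  }

module _ {n : ℕ} where
  open CommutativeSemigroupProperties (+V-commutativeSemigroup n) public
    using () renaming (interchange to +V-interchange; x∙yz≈y∙xz to +V-exchange)

comb-zero : ∀ {n d} (b : Vec (V n) d) → comb (replicate d false) b ≡ zeroV
comb-zero []      = refl
comb-zero (_ ∷ b) = comb-zero b

comb-+ : ∀ {n d} (c c′ : Vec Bool d) (b : Vec (V n) d) →
         comb (zipWith _xor_ c c′) b ≡ comb c b +V comb c′ b
comb-+ [] [] [] = sym (+V-identityˡ zeroV)
comb-+ (true ∷ c) (true ∷ c′) (x ∷ b) = begin
  comb (zipWith _xor_ c c′) b           ≡⟨ comb-+ c c′ b ⟩
  comb c b +V comb c′ b                 ≡⟨ sym (+V-identityˡ _) ⟩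
  zeroV +V (comb c b +V comb c′ b)      ≡⟨ cong (_+V _) (sym (+V-self x)) ⟩
  (x +V x) +V (comb c b +V comb c′ b)   ≡⟨ +V-interchange x x (comb c b) (comb c′ b) ⟩
  (x +V comb c b) +V (x +V comb c′ b)   ∎
  where open ≡-Reasoning
comb-+ (true ∷ c) (false ∷ c′) (x ∷ b) =
  trans (cong (x +V_) (comb-+ c c′ b)) (sym (+V-assoc x (comb c b) (comb c′ b)))
comb-+ (false ∷ c) (true ∷ c′) (x ∷ b) =
  trans (cong (x +V_) (comb-+ c c′ b)) (+V-exchange x (comb c b) (comb c′ b))
comb-+ (false ∷ c) (false ∷ c′) (x ∷ b) = comb-+ c c′ b

_≟V_ : ∀ {n} (v w : V n) → Dec (v ≡ w)
_≟V_ = ≡-dec Bool._≟_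

_==V_ : ∀ {n} → V n → V n → Bool
v ==V w = does (v ≟V w)

==V-refl : ∀ {n} (v : V n) → (v ==V v) ≡ true
==V-refl v = dec-true (v ≟V v) refl

==V⇒≡ : ∀ {n} {v w : V n} → (v ==V w) ≡ true → v ≡ w
==V⇒≡ {v = v} {w} e with v ≟V w
... | yes v≡w = v≡w

≡⇒==V : ∀ {n} {v w : V n} → v ≡ w → (v ==V w) ≡ true
≡⇒==V {v = v} refl = ==V-refl v

==V≡false⇒≢ : ∀ {n} {v w : V n} → (v ==V w) ≡ false → v ≢ w
==V≡false⇒≢ v≠w v≡w = contradiction (trans (sym v≠w) (≡⇒==V v≡w)) λ ()

nonzero : ∀ {n} → V n → Bool
nonzero v = not (v ==V zeroV)

nonzero⇒≢0 : ∀ {n} {v : V n} → nonzero v ≡ true → v ≢ zeroV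
nonzero⇒≢0 v≢0 = ==V≡false⇒≢ (not-true⁻ v≢0)

⟦_⟧ : Bool → ℕ
⟦ true ⟧  = 1
⟦ false ⟧ = 0

⟦⟧-mono : ∀ {a b} → (a ≡ true → b ≡ true) → ⟦ a ⟧ ≤ ⟦ b ⟧
⟦⟧-mono {true}  a⇒b rewrite a⇒b refl = ≤-refl
⟦⟧-mono {false} _ = z≤n

⟦∨⟧ : ∀ a b → ¬ (a ≡ true × b ≡ true) → ⟦ a ∨ b ⟧ ≡ ⟦ a ⟧ + ⟦ b ⟧
⟦∨⟧ true  true  disjoint = ⊥-elim (disjoint (refl , refl))
⟦∨⟧ true  false _ = refl
⟦∨⟧ false _     _ = refl

-- Opaque, as otherwise the type checker unfolds sums over all 2ⁿ points when comparing terms.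
opaque
  sumV : ∀ {n} → (V n → ℕ) → ℕ
  sumV {zero}  f = f []
  sumV {suc n} f = sumV (λ v → f (true ∷ v)) + sumV (λ v → f (false ∷ v))

  sumV-cong : ∀ {n} {f g : V n → ℕ} → (∀ v → f v ≡ g v) → sumV f ≡ sumV g
  sumV-cong {zero}  f≗g = f≗g []
  sumV-cong {suc n} f≗g = cong₂ _+_ (sumV-cong (f≗g ∘ (true ∷_))) (sumV-cong (f≗g ∘ (false ∷_)))

  sumV-mono : ∀ {n} {f g : V n → ℕ} → (∀ v → f v ≤ g v) → sumV f ≤ sumV g
  sumV-mono {zero}  f≤g = f≤g []
  sumV-mono {suc n} f≤g = +-mono-≤ (sumV-mono (f≤g ∘ (true ∷_))) (sumV-mono (f≤g ∘ (false ∷_)))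

  sumV-+ : ∀ {n} (f g : V n → ℕ) → sumV (λ v → f v + g v) ≡ sumV f + sumV g
  sumV-+ {zero}  f g = refl
  sumV-+ {suc n} f g = trans
    (cong₂ _+_ (sumV-+ (f ∘ (true ∷_)) (g ∘ (true ∷_))) (sumV-+ (f ∘ (false ∷_)) (g ∘ (false ∷_))))
    (+-interchange (sumV (f ∘ (true ∷_))) (sumV (g ∘ (true ∷_))) (sumV (f ∘ (false ∷_))) (sumV (g ∘ (false ∷_))))

  sumV-*ʳ : ∀ {n} (f : V n → ℕ) k → sumV (λ v → f v * k) ≡ sumV f * k
  sumV-*ʳ {zero}  f k = refl
  sumV-*ʳ {suc n} f k = trans (cong₂ _+_ (sumV-*ʳ (f ∘ (true ∷_)) k) (sumV-*ʳ (f ∘ (false ∷_)) k))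
                              (sym (*-distribʳ-+ k (sumV (f ∘ (true ∷_))) (sumV (f ∘ (false ∷_)))))

  sumV-const : ∀ {n} k → sumV {n} (λ _ → k) ≡ 2 ^ n * k
  sumV-const {zero}  k = sym (+-identityʳ k)
  sumV-const {suc n} k = trans (cong₂ _+_ (sumV-const {n} k) (sumV-const {n} k))
                               (sym (trans (*-assoc 2 (2 ^ n) k) (cong (2 ^ n * k +_) (+-identityʳ _))))

  sumV-translate : ∀ {n} (f : V n → ℕ) (w : V n) → sumV (λ v → f (v +V w)) ≡ sumV f
  sumV-translate {zero}  f [] = refl
  sumV-translate {suc n} f (true ∷ w) =
    trans (cong₂ _+_ (sumV-translate (f ∘ (false ∷_)) w) (sumV-translate (f ∘ (true ∷_)) w))
          (+-comm (sumV (f ∘ (false ∷_))) (sumV (f ∘ (true ∷_))))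
  sumV-translate {suc n} f (false ∷ w) =
    cong₂ _+_ (sumV-translate (f ∘ (true ∷_)) w) (sumV-translate (f ∘ (false ∷_)) w)

  sumV-point : ∀ {n} (f : V n → ℕ) (p : V n) →
               sumV f ≡ f p + sumV (λ v → if v ==V p then 0 else f v)
  sumV-point {zero}  f [] = sym (+-identityʳ (f []))
  sumV-point {suc n} f (true ∷ p) =
    trans (cong (_+ sumV (f ∘ (false ∷_))) (sumV-point (f ∘ (true ∷_)) p))
          (+-assoc (f (true ∷ p)) _ _)
  sumV-point {suc n} f (false ∷ p) =
    trans (cong (sumV (f ∘ (true ∷_)) +_) (sumV-point (f ∘ (false ∷_)) p))
          (+-exchange (sumV (f ∘ (true ∷_))) (f (false ∷ p)) _)

# : ∀ {n} → SubsetV n → ℕ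
# X = sumV (λ v → ⟦ X v ⟧)

_─_ : ∀ {n} → SubsetV n → V n → SubsetV n
(X ─ p) v = X v ∧ not (v ==V p)

#-cong : ∀ {n} {X Y : SubsetV n} → X ≗V Y → # X ≡ # Y
#-cong X≗Y = sumV-cong (cong ⟦_⟧ ∘ X≗Y)

#-mono : ∀ {n} {X Y : SubsetV n} → X ⊆V Y → # X ≤ # Y
#-mono X⊆Y = sumV-mono (λ v → ⟦⟧-mono (X⊆Y v))

#-≤-2^n : ∀ {n} (X : SubsetV n) → # X ≤ 2 ^ n
#-≤-2^n {n} X = ≤-trans (sumV-mono (λ v → ⟦⟧≤1 (X v))) (≤-reflexive (trans (sumV-const 1) (*-identityʳ (2 ^ n))))
  where
  ⟦⟧≤1 : ∀ a → ⟦ a ⟧ ≤ 1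
  ⟦⟧≤1 true  = ≤-refl
  ⟦⟧≤1 false = z≤n

#-─ : ∀ {n} (X : SubsetV n) p → # X ≡ ⟦ X p ⟧ + # (X ─ p)
#-─ X p = trans (sumV-point (λ v → ⟦ X v ⟧) p) (cong (⟦ X p ⟧ +_) (sumV-cong (λ v → if-as-∧ (v ==V p) (X v))))
  where
  if-as-∧ : ∀ e a → (if e then 0 else ⟦ a ⟧) ≡ ⟦ a ∧ not e ⟧
  if-as-∧ true  true  = refl
  if-as-∧ true  false = refl
  if-as-∧ false true  = refl
  if-as-∧ false false = refl

#-─∈ : ∀ {n} {X : SubsetV n} {p} → X p ≡ true → # X ≡ suc (# (X ─ p))
#-─∈ {X = X} {p} Xp = trans (#-─ X p) (cong (λ b → ⟦ b ⟧ + # (X ─ p)) Xp)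

#-∖0 : ∀ {n} {X : SubsetV n} → X zeroV ≡ true → # (X ∩V nonzero) ≡ # X ∸ 1
#-∖0 X∋0 = sym (cong (_∸ 1) (#-─∈ X∋0))

#nonzero : ∀ {n} → # (nonzero {n}) ≡ 2 ^ n ∸ 1
#nonzero {n} = trans (#-∖0 {X = λ _ → true} refl) (cong (_∸ 1) (trans (sumV-const 1) (*-identityʳ (2 ^ n))))

#-translate : ∀ {n} (X : SubsetV n) w → # (λ v → X (v +V w)) ≡ # X
#-translate X = sumV-translate (λ v → ⟦ X v ⟧)

#-∪-translate : ∀ {n} (X : SubsetV n) w → (∀ v → ¬ (X v ≡ true × X (v +V w) ≡ true)) →
                # (λ v → X v ∨ X (v +V w)) ≡ # X + # X
#-∪-translate X w disjoint = begin
  # (λ v → X v ∨ X (v +V w))                ≡⟨ sumV-cong (λ v → ⟦∨⟧ (X v) (X (v +V w)) (disjoint v)) ⟩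
  sumV (λ v → ⟦ X v ⟧ + ⟦ X (v +V w) ⟧)    ≡⟨ sumV-+ (λ v → ⟦ X v ⟧) (λ v → ⟦ X (v +V w) ⟧) ⟩
  # X + # (λ v → X (v +V w))               ≡⟨ cong (# X +_) (#-translate X w) ⟩
  # X + # X                                ∎
  where open ≡-Reasoning

#-empty : ∀ {n} {X : SubsetV n} → (∀ v → X v ≡ false) → # X ≡ 0
#-empty {n} none = trans (sumV-cong (cong ⟦_⟧ ∘ none)) (trans (sumV-const {n} 0) (*-zeroʳ (2 ^ n)))

search : ∀ {n} (X : SubsetV n) → (∃ λ v → X v ≡ true) ⊎ (∀ v → X v ≡ false)
search {zero} X with X [] in e
... | true  = inj₁ ([] , e)
... | false = inj₂ λ { [] → e }
search {suc n} X with search (X ∘ (true ∷_)) | search (X ∘ (false ∷_))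
... | inj₁ (v , e) | _            = inj₁ (true ∷ v , e)
... | inj₂ _       | inj₁ (v , e) = inj₁ (false ∷ v , e)
... | inj₂ none₁   | inj₂ none₀   = inj₂ λ { (true ∷ v) → none₁ v ; (false ∷ v) → none₀ v }

#-nonempty : ∀ {n} (X : SubsetV n) → 1 ≤ # X → ∃ λ v → X v ≡ true
#-nonempty {n} X 1≤#X with search X
... | inj₁ found = found
... | inj₂ none  = contradiction (#-empty none) (≢-sym (<⇒≢ 1≤#X))

#-pair : ∀ {n} (X : SubsetV n) → 2 ≤ # X → ∃₂ λ p q → X p ≡ true × X q ≡ true × (q ==V p) ≡ false
#-pair X 2≤#X with #-nonempty X (≤-trans (s≤s z≤n) 2≤#X)
... | p , Xp with #-nonempty (X ─ p) (s≤s⁻¹ (subst (2 ≤_) (#-─∈ Xp) 2≤#X))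
...   | q , X─p∋q = p , q , Xp , proj₁ (∧-true⁻ X─p∋q) , not-true⁻ (proj₂ (∧-true⁻ X─p∋q))

⊆∧#≥⇒⊇ : ∀ {n} {X Y : SubsetV n} → X ⊆V Y → # Y ≤ # X → Y ⊆V X
⊆∧#≥⇒⊇ {X = X} {Y} X⊆Y #Y≤#X v Yv with X v in Xv
... | true  = refl
... | false = contradiction #Y≤#X (<⇒≱ (begin-strict
  # X             ≡⟨ trans (#-─ X v) (cong (λ b → ⟦ b ⟧ + # (X ─ v)) Xv) ⟩
  # (X ─ v)       ≤⟨ #-mono (λ u → ∧-monoˡ (X⊆Y u)) ⟩
  # (Y ─ v)       <⟨ n<1+n _ ⟩
  suc (# (Y ─ v)) ≡⟨ #-─∈ Yv ⟨
  # Y             ∎))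
  where
  open ≤-Reasoning
  ∧-monoˡ : ∀ {a b c} → (a ≡ true → b ≡ true) → a ∧ c ≡ true → b ∧ c ≡ true
  ∧-monoˡ {true} a⇒b e rewrite a⇒b refl = e

-- Spans and dimension

Independent : ∀ {n d} → Vec (V n) d → Set
Independent {d = d} b = ∀ c → comb c b ≡ zeroV → c ≡ replicate d false

Independent-tail : ∀ {n d} {x : V n} {b : Vec (V n) d} → Independent (x ∷ b) → Independent b
Independent-tail ind c e = cong Data.Vec.tail (ind (false ∷ c) e)

Independent⇒comb≢head : ∀ {n d} {x : V n} {b : Vec (V n) d} → Independent (x ∷ b) → ∀ c → comb c b ≢ x
Independent⇒comb≢head {x = x} ind c e with ind (true ∷ c) (trans (cong (x +V_) e) (+V-self x))
... | ()

span : ∀ {n d} → Vec (V n) d → SubsetV n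
span []      v = v ==V zeroV
span (x ∷ b) v = span b v ∨ span b (v +V x)

span-comb : ∀ {n d} (c : Vec Bool d) (b : Vec (V n) d) → span b (comb c b) ≡ true
span-comb {n} []          []      = ==V-refl {n} zeroV
span-comb (true ∷ c)  (x ∷ b) = ∨-true⁺ʳ (span b (x +V comb c b))
  (subst (λ v → span b v ≡ true) (sym (trans (+V-comm _ x) (+V-cancelˡ (comb c b) x))) (span-comb c b))
span-comb (false ∷ c) (x ∷ b) = ∨-true⁺ˡ (span-comb c b)

span⇒comb : ∀ {n d} (b : Vec (V n) d) {v} → span b v ≡ true → ∃ λ c → comb c b ≡ v
span⇒comb []      {v} e = [] , sym (==V⇒≡ e)
span⇒comb (x ∷ b) {v} e with span b v in e₁
... | true  = let c , c↦v = span⇒comb b e₁ in false ∷ c , c↦v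
... | false = let c , c↦v+x = span⇒comb b e in
  true ∷ c , trans (cong (x +V_) c↦v+x) (trans (+V-comm x (v +V x)) (+V-cancelʳ v x))

#-span : ∀ {n d} (b : Vec (V n) d) → Independent b → # (span b) ≡ 2 ^ d
#-span {n} []      _   =
  trans (#-─∈ (==V-refl {n} zeroV)) (cong suc (#-empty (λ v → Bool.∧-inverseʳ (v ==V zeroV))))
#-span {d = suc d} (x ∷ b) ind = begin
  # (λ v → span b v ∨ span b (v +V x))  ≡⟨ #-∪-translate (span b) x disjoint ⟩
  # (span b) + # (span b)               ≡⟨ cong₂ _+_ #span-b (trans #span-b (sym (+-identityʳ _))) ⟩
  2 ^ d + (2 ^ d + 0)                   ∎
  where
  open ≡-Reasoning
  #span-b : # (span b) ≡ 2 ^ d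
  #span-b = #-span b (Independent-tail ind)
  disjoint : ∀ v → ¬ (span b v ≡ true × span b (v +V x) ≡ true)
  disjoint v (e₁ , e₂) with span⇒comb b e₁ | span⇒comb b e₂
  ... | c₁ , c₁↦v | c₂ , c₂↦v+x = Independent⇒comb≢head ind (zipWith _xor_ c₁ c₂)
    (trans (comb-+ c₁ c₂ b) (trans (cong₂ _+V_ c₁↦v c₂↦v+x) (+V-cancelˡ x v)))

record IsSubspace {n} (X : SubsetV n) : Set where
  field
    zero∈ : X zeroV ≡ true
    +-closed : ∀ {v w} → X v ≡ true → X w ≡ true → X (v +V w) ≡ true

IsSubspace-∩ : ∀ {n} {X Y : SubsetV n} → IsSubspace X → IsSubspace Y → IsSubspace (X ∩V Y)
IsSubspace-∩ X-sub Y-sub = record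
  { zero∈ = ∧-true⁺ (IsSubspace.zero∈ X-sub) (IsSubspace.zero∈ Y-sub)
  ; +-closed = λ e₁ e₂ → let (Xv , Yv) = ∧-true⁻ e₁ ; (Xw , Yw) = ∧-true⁻ e₂ in
      ∧-true⁺ (IsSubspace.+-closed X-sub Xv Xw) (IsSubspace.+-closed Y-sub Yv Yw)
  }

comb∈ : ∀ {n d} {X : SubsetV n} {b : Vec (V n) d} → IsSubspace X → VecAll.All (λ v → X v ≡ true) b →
        ∀ c → X (comb c b) ≡ true
comb∈ X-sub []          []         = IsSubspace.zero∈ X-sub
comb∈ X-sub (Xx ∷ Xb) (true ∷ c)  = IsSubspace.+-closed X-sub Xx (comb∈ X-sub Xb c)
comb∈ X-sub (Xx ∷ Xb) (false ∷ c) = comb∈ X-sub Xb c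

HasDim-span : ∀ {n d} (b : Vec (V n) d) → Independent b → HasDim (span b) d
HasDim-span b ind = b , ind , (λ v → span⇒comb b) , (λ c → span-comb c b)

HasDim⇒≗span : ∀ {n d} {X : SubsetV n} (dim : HasDim X d) → X ≗V span (proj₁ dim)
HasDim⇒≗span {X = X} (b , _ , spanning , X∋comb) v = Bool-ext
  (λ Xv → let c , c↦v = spanning v Xv in subst (λ u → span b u ≡ true) c↦v (span-comb c b))
  (λ bv → let c , c↦v = span⇒comb b bv in subst (λ u → X u ≡ true) c↦v (X∋comb c))

#-HasDim : ∀ {n d} {X : SubsetV n} → HasDim X d → # X ≡ 2 ^ d
#-HasDim dim@(b , ind , _) = trans (#-cong (HasDim⇒≗span dim)) (#-span b ind)

HasDim⇒IsSubspace : ∀ {n d} {X : SubsetV n} → HasDim X d → IsSubspace X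
HasDim⇒IsSubspace {X = X} dim@(b , _ , _ , X∋comb) = record
  { zero∈ = subst (λ u → X u ≡ true) (comb-zero b) (X∋comb (replicate _ false))
  ; +-closed = λ {v} {w} Xv Xw →
      let c , c↦v = span⇒comb b (trans (sym (X≗b v)) Xv) ; c′ , c′↦w = span⇒comb b (trans (sym (X≗b w)) Xw) in
      subst (λ u → X u ≡ true) (trans (comb-+ c c′ b) (cong₂ _+V_ c↦v c′↦w)) (X∋comb (zipWith _xor_ c c′))
  }
  where
  X≗b : X ≗V span b
  X≗b = HasDim⇒≗span dim

^-cancelʳ-≤ : ∀ m {i j} → 1 < m → m ^ i ≤ m ^ j → i ≤ j
^-cancelʳ-≤ m 1<m mⁱ≤mʲ = ≮⇒≥ (λ j<i → <⇒≱ (^-monoʳ-< m 1<m j<i) mⁱ≤mʲ)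

^-injectiveʳ : ∀ m {i j} → 1 < m → m ^ i ≡ m ^ j → i ≡ j
^-injectiveʳ m 1<m e = ≤-antisym (^-cancelʳ-≤ m 1<m (≤-reflexive e)) (^-cancelʳ-≤ m 1<m (≤-reflexive (sym e)))

Independent⇒≤ : ∀ {n d} (b : Vec (V n) d) → Independent b → d ≤ n
Independent⇒≤ {n} b ind = ^-cancelʳ-≤ 2 ≤-refl (subst (_≤ 2 ^ n) (#-span b ind) (#-≤-2^n (span b)))

module _ {n} {X : SubsetV n} (X-sub : IsSubspace X) where

  private
    extend : ∀ f {d} (b : Vec (V n) d) → Independent b → VecAll.All (λ v → X v ≡ true) b →
             d + f ≡ suc n → ∃ (HasDim X)
    extend zero {d} b ind _ d+0≡1+n =
      contradiction (Independent⇒≤ b ind) (<⇒≱ (≤-reflexive (trans (sym d+0≡1+n) (+-identityʳ d))))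
    extend (suc f) {d} b ind Xb d+1+f≡1+n with search (λ v → X v ∧ not (span b v))
    ... | inj₂ X∖span≡∅ = d , b , ind , (λ v Xv → span⇒comb b (∧-not≡false⇒ Xv (X∖span≡∅ v))) , comb∈ X-sub Xb
    ... | inj₁ (v , v∈X∖span) = extend f (v ∷ b) ind′ (Xv ∷ Xb) (trans (sym (+-suc d f)) d+1+f≡1+n)
      where
      Xv : X v ≡ true
      Xv = proj₁ (∧-true⁻ v∈X∖span)
      v∉span : span b v ≡ false
      v∉span = not-true⁻ (proj₂ (∧-true⁻ v∈X∖span))
      ind′ : Independent (v ∷ b)
      ind′ (true ∷ c) v+c≡0 = contradiction
        (trans (sym v∉span) (subst (λ u → span b u ≡ true) (sym (+V≡zero⇒≡ v+c≡0)) (span-comb c b))) λ ()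
      ind′ (false ∷ c) c≡0 = cong (false ∷_) (ind c c≡0)

  IsSubspace⇒HasDim : ∃ (HasDim X)
  IsSubspace⇒HasDim = extend (suc n) [] (λ { [] _ → refl }) [] refl

span⊆ : ∀ {n d} {X : SubsetV n} {b : Vec (V n) d} → IsSubspace X → VecAll.All (λ v → X v ≡ true) b → span b ⊆V X
span⊆ {X = X} {b} X-sub Xb v v∈span = let c , c↦v = span⇒comb b v∈span in
  subst (λ u → X u ≡ true) c↦v (comb∈ X-sub Xb c)

Independent-pair : ∀ {n} {p q : V n} → nonzero p ≡ true → nonzero q ≡ true → (q ==V p) ≡ false →
                   Independent (p ∷ q ∷ [])
Independent-pair {p = p} {q} p≢0 q≢0 q≢p = λ where
  (true  ∷ true  ∷ []) p+q≡0 → contradiction (sym (trans (+V≡zero⇒≡ p+q≡0) (+V-identityʳ q))) (==V≡false⇒≢ q≢p)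
  (true  ∷ false ∷ []) p≡0   → contradiction (trans (sym (+V-identityʳ p)) p≡0) (nonzero⇒≢0 p≢0)
  (false ∷ true  ∷ []) q≡0   → contradiction (trans (sym (+V-identityʳ q)) q≡0) (nonzero⇒≢0 q≢0)
  (false ∷ false ∷ []) _     → refl

span-pair∋ : ∀ {n} (p q : V n) → span (p ∷ q ∷ []) p ≡ true × span (p ∷ q ∷ []) q ≡ true
span-pair∋ p q = subst (λ v → span b v ≡ true) (+V-identityʳ p) (span-comb (true ∷ false ∷ []) b)
               , subst (λ v → span b v ≡ true) (+V-identityʳ q) (span-comb (false ∷ true ∷ []) b)
  where
  b : Vec (V _) 2
  b = p ∷ q ∷ []

sumL : ∀ {A : Set} → (A → ℕ) → List A → ℕ
sumL f []       = 0
sumL f (x ∷ xs) = f x + sumL f xs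

count : ∀ {A : Set} → (A → Bool) → List A → ℕ
count g = sumL (⟦_⟧ ∘ g)

module _ {A : Set} where

  sumL-cong-All : ∀ {P : A → Set} {f g : A → ℕ} {xs} → All P xs → (∀ {x} → P x → f x ≡ g x) →
                  sumL f xs ≡ sumL g xs
  sumL-cong-All []         f≗g = refl
  sumL-cong-All (px ∷ pxs) f≗g = cong₂ _+_ (f≗g px) (sumL-cong-All pxs f≗g)

  sumL-cong : ∀ {f g : A → ℕ} → (∀ x → f x ≡ g x) → ∀ xs → sumL f xs ≡ sumL g xs
  sumL-cong f≗g []       = refl
  sumL-cong f≗g (x ∷ xs) = cong₂ _+_ (f≗g x) (sumL-cong f≗g xs)

  sumL-+ : ∀ (f g : A → ℕ) xs → sumL (λ x → f x + g x) xs ≡ sumL f xs + sumL g xs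
  sumL-+ f g []       = refl
  sumL-+ f g (x ∷ xs) =
    trans (cong (f x + g x +_) (sumL-+ f g xs)) (+-interchange (f x) (g x) (sumL f xs) (sumL g xs))

  sumL-*ˡ : ∀ k (f : A → ℕ) xs → sumL (λ x → k * f x) xs ≡ k * sumL f xs
  sumL-*ˡ k f []       = sym (*-zeroʳ k)
  sumL-*ˡ k f (x ∷ xs) = trans (cong (k * f x +_) (sumL-*ˡ k f xs)) (sym (*-distribˡ-+ k (f x) (sumL f xs)))

  sumL-*ʳ : ∀ (f : A → ℕ) k xs → sumL (λ x → f x * k) xs ≡ sumL f xs * k
  sumL-*ʳ f k []       = refl
  sumL-*ʳ f k (x ∷ xs) = trans (cong (f x * k +_) (sumL-*ʳ f k xs)) (sym (*-distribʳ-+ k (f x) (sumL f xs)))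

  sumL-linear₄ : ∀ a b c d (f g h k : A → ℕ) xs →
                 sumL (λ x → a * f x + (b * g x + (c * h x + d * k x))) xs
                 ≡ a * sumL f xs + (b * sumL g xs + (c * sumL h xs + d * sumL k xs))
  sumL-linear₄ a b c d f g h k xs =
    trans (sumL-+ _ _ xs) (cong₂ _+_ (sumL-*ˡ a f xs)
    (trans (sumL-+ _ _ xs) (cong₂ _+_ (sumL-*ˡ b g xs)
    (trans (sumL-+ _ _ xs) (cong₂ _+_ (sumL-*ˡ c h xs) (sumL-*ˡ d k xs))))))

  sumL-sumV : ∀ {n} (f : A → V n → ℕ) xs → sumL (λ x → sumV (f x)) xs ≡ sumV (λ v → sumL (λ x → f x v) xs)
  sumL-sumV {n} f []       = sym (trans (sumV-const {n} 0) (*-zeroʳ (2 ^ n)))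
  sumL-sumV     f (x ∷ xs) =
    trans (cong (sumV (f x) +_) (sumL-sumV f xs)) (sym (sumV-+ (f x) (λ v → sumL (λ y → f y v) xs)))

reflects : ∀ {A : Set} {b} → (b ≡ true → A) → (A → b ≡ true) → Reflects A b
reflects {b = true}  sound _        = ofʸ (sound refl)
reflects {b = false} _     complete = ofⁿ (λ a → contradiction (complete a) λ ())

module _ {A : Set} {P : A → Set} where

  CountP-count : ∀ {g : A → Bool} {xs} → All (λ x → Reflects (P x) (g x)) xs → CountP P xs (count g xs)
  CountP-count []                     = cnil
  CountP-count {g} {x ∷ _} (r ∷ rs) with g x | r
  ... | true  | ofʸ px  = cyes px (CountP-count rs)
  ... | false | ofⁿ ¬px = cno ¬px (CountP-count rs)

  CountP-functional : ∀ {xs k l} → CountP P xs k → CountP P xs l → k ≡ l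
  CountP-functional cnil         cnil          = refl
  CountP-functional (cyes _ c)   (cyes _ c′)   = cong suc (CountP-functional c c′)
  CountP-functional (cyes px _)  (cno ¬px _)   = contradiction px ¬px
  CountP-functional (cno ¬px _)  (cyes px _)   = contradiction px ¬px
  CountP-functional (cno _ c)    (cno _ c′)    = CountP-functional c c′

  CountP-Any : ∀ {xs k} → CountP P xs k → Any P xs → 1 ≤ k
  CountP-Any (cyes _ _)  _          = s≤s z≤n
  CountP-Any (cno ¬px _) (here px)  = contradiction px ¬px
  CountP-Any (cno _ c)   (there pxs) = CountP-Any c pxs

  CountP-suc⇒Any : ∀ {xs k} → CountP P xs (suc k) → Any P xs
  CountP-suc⇒Any (cyes px _) = here px
  CountP-suc⇒Any (cno _ c)   = there (CountP-suc⇒Any c)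

  CountP-zero : ∀ {xs} → CountP P xs 0 → All (¬_ ∘ P) xs
  CountP-zero cnil        = []
  CountP-zero (cno ¬px c) = ¬px ∷ CountP-zero c

  CountP-≤1⇒AllPairs : ∀ {xs k} → CountP P xs k → k ≤ 1 → AllPairs (λ x y → P x → ¬ P y) xs
  CountP-≤1⇒AllPairs cnil        _         = []
  CountP-≤1⇒AllPairs (cyes _ c)  (s≤s z≤n) = All.map (λ ¬py _ → ¬py) (CountP-zero c) ∷ CountP-≤1⇒AllPairs c z≤n
  CountP-≤1⇒AllPairs (cno ¬px c) k≤1       =
    All.universal (λ _ px → contradiction px ¬px) _ ∷ CountP-≤1⇒AllPairs c k≤1

  AllPairs⇒CountP-≤1 : ∀ {xs k} → AllPairs (λ x y → P x → ¬ P y) xs → CountP P xs k → k ≤ 1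
  AllPairs⇒CountP-≤1 _              cnil        = z≤n
  AllPairs⇒CountP-≤1 (excl ∷ _)     (cyes px c) =
    s≤s (≤-reflexive (CountP-functional c (none (All.map (_$ px) excl))))
    where
    none : ∀ {ys} → All (¬_ ∘ P) ys → CountP P ys 0
    none []           = cnil
    none (¬py ∷ ¬pys) = cno ¬py (none ¬pys)
  AllPairs⇒CountP-≤1 (_ ∷ excls)    (cno _ c)   = AllPairs⇒CountP-≤1 excls c

AllPairs-∀ : ∀ {A T : Set} {R : T → A → A → Set} {xs} →
             (∀ t → AllPairs (R t) xs) → AllPairs (λ x y → ∀ t → R t x y) xs
AllPairs-∀ {xs = []}     _  = []
AllPairs-∀ {xs = x ∷ xs} rs =
  All.tabulate (λ y∈xs t → All.lookup (AllPairs.head (rs t)) y∈xs) ∷ AllPairs-∀ (AllPairs.tail ∘ rs)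

All⇒AllPairs : ∀ {A : Set} {P : A → Set} {xs} → All P xs → AllPairs (λ x y → P x × P y) xs
All⇒AllPairs []         = []
All⇒AllPairs (px ∷ pxs) = All.map (px ,_) pxs ∷ All⇒AllPairs pxs

-- Double counting

#pairs : ∀ {n} → SubsetV n → SubsetV n → ℕ
#pairs X Y = sumV λ p → sumV λ q → ⟦ X p ∧ (Y q ∧ not (q ==V p)) ⟧

#pairs-⊆ : ∀ {n} {X Y : SubsetV n} → X ⊆V Y → #pairs X Y ≡ # X * (# Y ∸ 1)
#pairs-⊆ {X = X} {Y} X⊆Y = trans (sumV-cong partners) (sumV-*ʳ (λ p → ⟦ X p ⟧) (# Y ∸ 1))
  where
  partners : ∀ p → sumV (λ q → ⟦ X p ∧ (Y q ∧ not (q ==V p)) ⟧) ≡ ⟦ X p ⟧ * (# Y ∸ 1)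
  partners p with X p in Xp
  ... | false = #-empty (λ _ → refl)
  ... | true  = sym (trans (+-identityʳ _) (cong (_∸ 1) (#-─∈ (X⊆Y p Xp))))

⟦∧⟧-factor : ∀ u w x y e → ⟦ (u ∧ x) ∧ ((w ∧ y) ∧ e) ⟧ ≡ ⟦ u ∧ w ⟧ * ⟦ x ∧ (y ∧ e) ⟧
⟦∧⟧-factor false _     _     _ _ = refl
⟦∧⟧-factor true  false false _ _ = refl
⟦∧⟧-factor true  false true  _ _ = refl
⟦∧⟧-factor true  true  x     y e = sym (+-identityʳ _)

-- Ordered pairs of distinct points of X × Y are counted once through the unique member of C containing both.
module _ {n} (C : List (SubsetV n))
         (unique-member : ∀ {p q} → nonzero p ≡ true → nonzero q ≡ true → (q ==V p) ≡ false →
                          count (λ U → U p ∧ U q) C ≡ 1) where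

  #pairs-double-count : ∀ {X Y : SubsetV n} → X ⊆V nonzero → Y ⊆V nonzero →
                        sumL (λ U → #pairs (U ∩V X) (U ∩V Y)) C ≡ #pairs X Y
  #pairs-double-count {X} {Y} X⊆nz Y⊆nz = begin
    sumL (λ U → sumV λ p → sumV λ q → summand U p q) C    ≡⟨ sumL-sumV (λ U p → sumV (summand U p)) C ⟩
    sumV (λ p → sumL (λ U → sumV (summand U p)) C)        ≡⟨ sumV-cong (λ p → sumL-sumV (λ U → summand U p) C) ⟩
    sumV (λ p → sumV λ q → sumL (λ U → summand U p q) C)  ≡⟨ sumV-cong (λ p → sumV-cong (pair p)) ⟩
    #pairs X Y                                            ∎
    where
    open ≡-Reasoning
    summand : SubsetV n → V n → V n → ℕ
    summand U p q = ⟦ (U p ∧ X p) ∧ ((U q ∧ Y q) ∧ not (q ==V p)) ⟧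

    pair : ∀ p q → sumL (λ U → summand U p q) C ≡ ⟦ X p ∧ (Y q ∧ not (q ==V p)) ⟧
    pair p q = begin
      sumL (λ U → summand U p q) C                      ≡⟨ sumL-cong (λ U → ⟦∧⟧-factor (U p) (U q) _ _ _) C ⟩
      sumL (λ U → ⟦ U p ∧ U q ⟧ * ⟦ distinct ⟧) C       ≡⟨ sumL-*ʳ (λ U → ⟦ U p ∧ U q ⟧) ⟦ distinct ⟧ C ⟩
      count (λ U → U p ∧ U q) C * ⟦ distinct ⟧          ≡⟨ through-one distinct refl ⟩
      ⟦ distinct ⟧                                      ∎
      where
      distinct : Bool
      distinct = X p ∧ (Y q ∧ not (q ==V p))
      through-one : ∀ b → distinct ≡ b → count (λ U → U p ∧ U q) C * ⟦ b ⟧ ≡ ⟦ b ⟧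
      through-one false _ = *-zeroʳ (count (λ U → U p ∧ U q) C)
      through-one true  e with ∧-true⁻ e
      ... | Xp , Yq∧q≢p with ∧-true⁻ Yq∧q≢p
      ...   | Yq , q≢p = cong (_* 1) (unique-member (X⊆nz p Xp) (Y⊆nz q Yq) (not-true⁻ q≢p))

#-partition : ∀ {n} (X Y : SubsetV n) → # X ≡ # (λ v → X v ∧ not (Y v)) + # (X ∩V Y)
#-partition X Y = trans (sumV-cong (λ v → split (X v) (Y v))) (sumV-+ _ _)
  where
  split : ∀ a b → ⟦ a ⟧ ≡ ⟦ a ∧ not b ⟧ + ⟦ a ∧ b ⟧
  split true  true  = refl
  split true  false = refl
  split false _     = refl

-- Pick w ∈ W ∖ U. Since U has index 2 in S, S = U ∪ (U + w), so v ↦ v + w maps W ∖ U into W ∩ U.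
module _ {n} {U W S : SubsetV n} (U-sub : IsSubspace U) (W-sub : IsSubspace W) (S-sub : IsSubspace S)
         (U⊆S : U ⊆V S) (W⊆S : W ⊆V S) (#S≡#U+#U : # S ≡ # U + # U) (#W≡#U : # W ≡ # U)
         (U≢W : ¬ U ≗V W) where

  private
    W∖U : SubsetV n
    W∖U v = W v ∧ not (U v)

    witness : ∃ λ w → W∖U w ≡ true
    witness with search W∖U
    ... | inj₁ found = found
    ... | inj₂ W∖U≡∅ = contradiction (λ v → Bool-ext (U⊆W v) (W⊆U v)) U≢W
      where
      W⊆U : W ⊆V U
      W⊆U v Wv = ∧-not≡false⇒ Wv (W∖U≡∅ v)
      U⊆W : U ⊆V W
      U⊆W = ⊆∧#≥⇒⊇ W⊆U (≤-reflexive (sym #W≡#U))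

    w : V n
    w = proj₁ witness
    Ww : W w ≡ true
    Ww = proj₁ (∧-true⁻ (proj₂ witness))
    w∉U : U w ≡ false
    w∉U = not-true⁻ (proj₂ (∧-true⁻ (proj₂ witness)))

    U∪U+w : SubsetV n
    U∪U+w v = U v ∨ U (v +V w)

    U-disjoint-U+w : ∀ v → ¬ (U v ≡ true × U (v +V w) ≡ true)
    U-disjoint-U+w v (Uv , Uv+w) = contradiction
      (trans (sym w∉U) (subst (λ u → U u ≡ true) (+V-cancelˡ w v) (IsSubspace.+-closed U-sub Uv Uv+w))) λ ()

    U∪U+w⊆S : U∪U+w ⊆V S
    U∪U+w⊆S v e with U v in Uv
    ... | true  = U⊆S v Uv
    ... | false = subst (λ u → S u ≡ true) (+V-cancelʳ v w) (IsSubspace.+-closed S-sub (U⊆S _ e) (W⊆S w Ww))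

    S⊆U∪U+w : S ⊆V U∪U+w
    S⊆U∪U+w = ⊆∧#≥⇒⊇ U∪U+w⊆S (≤-reflexive (trans #S≡#U+#U (sym (#-∪-translate U w U-disjoint-U+w))))

    translate-W∖U : ∀ v → W∖U v ≡ true → (W ∩V U) (v +V w) ≡ true
    translate-W∖U v e with ∧-true⁻ e
    ... | Wv , v∉U = ∧-true⁺ (IsSubspace.+-closed W-sub Wv Ww) (∨-resolve (not-true⁻ v∉U) (S⊆U∪U+w v (W⊆S v Wv)))

  #-∩-index2 : # U ≤ # (W ∩V U) + # (W ∩V U)
  #-∩-index2 = begin
    # U                                    ≡⟨ #W≡#U ⟨
    # W                                    ≡⟨ #-partition W U ⟩
    # W∖U + # (W ∩V U)                     ≤⟨ +-monoˡ-≤ (# (W ∩V U)) #W∖U≤#W∩U ⟩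
    # (W ∩V U) + # (W ∩V U)                ∎
    where
    open ≤-Reasoning
    #W∖U≤#W∩U : # W∖U ≤ # (W ∩V U)
    #W∖U≤#W∩U = ≤-trans (#-mono translate-W∖U) (≤-reflexive (#-translate (W ∩V U) w))

line-in-large-subspace : ∀ {n} {X : SubsetV n} → IsSubspace X → 2 < # X → ∃ λ T → HasDim T 2 × T ⊆V X
line-in-large-subspace {X = X} X-sub 2<#X
  with #-pair (X ∩V nonzero) (subst (2 ≤_) (sym (#-∖0 (IsSubspace.zero∈ X-sub))) (∸-monoˡ-≤ 1 2<#X))
... | p , q , p∈X⁺ , q∈X⁺ , q≢p with ∧-true⁻ p∈X⁺ | ∧-true⁻ q∈X⁺
...   | Xp , p≢0 | Xq , q≢0 =
  span (p ∷ q ∷ []) , HasDim-span _ (Independent-pair p≢0 q≢0 q≢p) , span⊆ X-sub (Xp ∷ Xq ∷ [])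

m+m≤n+n⇒m≤n : ∀ {m n} → m + m ≤ n + n → m ≤ n
m+m≤n+n⇒m≤n m+m≤n+n = ≮⇒≥ (λ n<m → <⇒≱ (+-mono-< n<m n<m) m+m≤n+n)

*+-cancel : ∀ k .{{_ : NonZero k}} x y r → k * x + r ≡ k * y + r → x ≡ y
*+-cancel k x y r e = *-cancelˡ-≡ x y k (+-cancelʳ-≡ r (k * x) (k * y) e)

-- The intersection vector

module IntersectionVector
  (C : List (SubsetV 7))
  (C-distinct : AllPairs (λ U W → ¬ (U ≗V W)) C)
  (C-dim3 : All (λ U → HasDim U 3) C)
  (C-lines : ∀ T → HasDim T 2 → CountP (λ U → T ⊆V U) C 1)
  (S : SubsetV 7) (S-dim4 : HasDim S 4) where

  S-sub : IsSubspace S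
  S-sub = HasDim⇒IsSubspace S-dim4

  m : SubsetV 7 → ℕ
  m U = # (U ∩V S)

  record Block (U : SubsetV 7) : Set where
    field
      subspace : IsSubspace U
      #U≡8 : # U ≡ 8
      dim∩ : ℕ
      hasDim∩ : HasDim (U ∩V S) dim∩
      dim∩≤3 : dim∩ ≤ 3

    m≡2^dim∩ : m U ≡ 2 ^ dim∩
    m≡2^dim∩ = #-HasDim hasDim∩

  block : ∀ {U} → HasDim U 3 → Block U
  block {U} U-dim3 = record
    { subspace = U-sub
    ; #U≡8 = #-HasDim U-dim3
    ; dim∩ = proj₁ ∩-dim
    ; hasDim∩ = proj₂ ∩-dim
    ; dim∩≤3 = ^-cancelʳ-≤ 2 ≤-refl
        (subst₂ _≤_ (#-HasDim (proj₂ ∩-dim)) (#-HasDim U-dim3) (#-mono (λ v → proj₁ ∘ ∧-true⁻)))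
    }
    where
    U-sub : IsSubspace U
    U-sub = HasDim⇒IsSubspace U-dim3
    ∩-dim : ∃ (HasDim (U ∩V S))
    ∩-dim = IsSubspace⇒HasDim (IsSubspace-∩ U-sub S-sub)

  blocks : All Block C
  blocks = All.map block C-dim3

  by-class : (P : ℕ → Set) → P 1 → P 2 → P 4 → P 8 → ∀ {U} → Block U → P (m U)
  by-class P p₁ p₂ p₄ p₈ b = subst P (sym m≡2^dim∩) (at-power dim∩≤3)
    where
    open Block b
    at-power : ∀ {k} → k ≤ 3 → P (2 ^ k)
    at-power z≤n                   = p₁
    at-power (s≤s z≤n)             = p₂
    at-power (s≤s (s≤s z≤n))       = p₄
    at-power (s≤s (s≤s (s≤s z≤n))) = p₈

  c : ℕ → ℕ
  c i = count (λ U → does (m U ≟ 2 ^ i)) C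

  CountP-dim : ∀ i → CountP (λ U → HasDim (U ∩V S) i) C (c i)
  CountP-dim i = CountP-count (All.map (λ {U} b → proof (map′ (dim-of b) #-HasDim (m U ≟ 2 ^ i))) blocks)
    where
    dim-of : ∀ {U} → Block U → m U ≡ 2 ^ i → HasDim (U ∩V S) i
    dim-of b m≡2^i = subst (HasDim _) (^-injectiveʳ 2 ≤-refl (trans (sym m≡2^dim∩) m≡2^i)) hasDim∩
      where open Block b

  CountP-⊆S : CountP (λ U → U ⊆V S) C (c 3)
  CountP-⊆S = CountP-count (All.map (λ {U} b → proof (map′ (⊆S b) (m≡8 b) (m U ≟ 8))) blocks)
    where
    ⊆S : ∀ {U} → Block U → m U ≡ 8 → U ⊆V S
    ⊆S {U} b m≡8 v Uv = proj₂ (∧-true⁻ (⊆∧#≥⇒⊇ (λ _ → proj₁ ∘ ∧-true⁻) (≤-reflexive (trans #U≡8 (sym m≡8))) v Uv))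
      where open Block b
    m≡8 : ∀ {U} → Block U → U ⊆V S → m U ≡ 8
    m≡8 {U} b U⊆S = trans (#-cong (λ v → Bool-ext (proj₁ ∘ ∧-true⁻) (λ Uv → ∧-true⁺ Uv (U⊆S v Uv)))) #U≡8
      where open Block b

  -- Agrees with h at 1, 2, 4, 8, the only values m takes on C.
  interpolate : (ℕ → ℕ) → ℕ → ℕ
  interpolate h x =
    h 1 * ⟦ does (x ≟ 1) ⟧ + (h 2 * ⟦ does (x ≟ 2) ⟧ + (h 4 * ⟦ does (x ≟ 4) ⟧ + h 8 * ⟦ does (x ≟ 8) ⟧))

  sumL-by-class : (h : ℕ → ℕ) → h 1 ≡ interpolate h 1 → h 2 ≡ interpolate h 2 → h 4 ≡ interpolate h 4 →
                  h 8 ≡ interpolate h 8 → sumL (h ∘ m) C ≡ h 1 * c 0 + (h 2 * c 1 + (h 4 * c 2 + h 8 * c 3))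
  sumL-by-class h e₁ e₂ e₄ e₈ =
    trans (sumL-cong-All blocks (by-class (λ x → h x ≡ interpolate h x) e₁ e₂ e₄ e₈))
          (sumL-linear₄ (h 1) (h 2) (h 4) (h 8) _ _ _ _ C)

  unique-member : ∀ {p q} → nonzero p ≡ true → nonzero q ≡ true → (q ==V p) ≡ false →
                  count (λ U → U p ∧ U q) C ≡ 1
  unique-member {p} {q} p≢0 q≢0 q≢p = CountP-functional
    (CountP-count (All.map (λ b → reflects (line⊆ b) ⊆⇒∋) blocks))
    (C-lines line (HasDim-span _ (Independent-pair p≢0 q≢0 q≢p)))
    where
    line = span (p ∷ q ∷ [])
    line⊆ : ∀ {U} → Block U → U p ∧ U q ≡ true → line ⊆V U
    line⊆ b pq∈U = let Up , Uq = ∧-true⁻ pq∈U in span⊆ (Block.subspace b) (Up ∷ Uq ∷ [])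
    ⊆⇒∋ : ∀ {U} → line ⊆V U → U p ∧ U q ≡ true
    ⊆⇒∋ line⊆U = ∧-true⁺ (line⊆U p (proj₁ (span-pair∋ p q))) (line⊆U q (proj₂ (span-pair∋ p q)))

  sumL-pairs : ∀ {X Y : SubsetV 7} → X ⊆V Y → Y ⊆V nonzero → ∀ {x y} → # X ≡ x → # Y ≡ y →
               (h : ℕ → ℕ) → (∀ {U} → Block U → # (U ∩V X) * (# (U ∩V Y) ∸ 1) ≡ h (m U)) →
               sumL (h ∘ m) C ≡ x * (y ∸ 1)
  sumL-pairs {X} {Y} X⊆Y Y⊆nz refl refl h h≡ = begin
    sumL (h ∘ m) C
      ≡⟨ sumL-cong-All blocks (λ b → sym (trans (#pairs-⊆ U∩X⊆U∩Y) (h≡ b))) ⟩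
    sumL (λ U → #pairs (U ∩V X) (U ∩V Y)) C
      ≡⟨ #pairs-double-count C unique-member (λ v → Y⊆nz v ∘ X⊆Y v) Y⊆nz ⟩
    #pairs X Y
      ≡⟨ #pairs-⊆ X⊆Y ⟩
    # X * (# Y ∸ 1)
      ∎
    where
    open ≡-Reasoning
    U∩X⊆U∩Y : ∀ {U} → (U ∩V X) ⊆V (U ∩V Y)
    U∩X⊆U∩Y v e = let Uv , Xv = ∧-true⁻ e in ∧-true⁺ Uv (X⊆Y v Xv)

  S⁺ : SubsetV 7
  S⁺ = S ∩V nonzero

  #S⁺ : # S⁺ ≡ 15
  #S⁺ = trans (#-∖0 (IsSubspace.zero∈ S-sub)) (cong (_∸ 1) (#-HasDim S-dim4))

  #U∩S⁺ : ∀ {U} → Block U → # (U ∩V S⁺) ≡ m U ∸ 1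
  #U∩S⁺ {U} b = trans (#-cong (λ v → sym (∧-assoc (U v) (S v) (nonzero v))))
                      (#-∖0 (IsSubspace.zero∈ (IsSubspace-∩ (Block.subspace b) S-sub)))

  #U∩nonzero : ∀ {U} → Block U → # (U ∩V nonzero) ≡ 7
  #U∩nonzero b = trans (#-∖0 (IsSubspace.zero∈ (Block.subspace b))) (cong (_∸ 1) (Block.#U≡8 b))

  pairs-in-S : 6 * c 2 + 42 * c 3 ≡ 15 * 14
  pairs-in-S = trans (sym (sumL-by-class h refl refl refl refl))
    (sumL-pairs (λ _ e → e) (λ _ → proj₂ ∘ ∧-true⁻) #S⁺ #S⁺ h (λ b → cong (λ x → x * (x ∸ 1)) (#U∩S⁺ b)))
    where
    h : ℕ → ℕ
    h x = (x ∸ 1) * (x ∸ 1 ∸ 1)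

  pairs-from-S : 6 * c 1 + (18 * c 2 + 42 * c 3) ≡ 15 * 126
  pairs-from-S = trans (sym (sumL-by-class h refl refl refl refl))
    (sumL-pairs (λ _ → proj₂ ∘ ∧-true⁻) (λ _ e → e) #S⁺ #nonzero h
                (λ b → cong₂ (λ x y → x * (y ∸ 1)) (#U∩S⁺ b) (#U∩nonzero b)))
    where
    h : ℕ → ℕ
    h x = (x ∸ 1) * 6

  all-pairs : 42 * c 0 + (42 * c 1 + (42 * c 2 + 42 * c 3)) ≡ 127 * 126
  all-pairs = trans (sym (sumL-by-class h refl refl refl refl))
    (sumL-pairs (λ _ e → e) (λ _ e → e) #nonzero #nonzero h (λ b → cong (λ x → x * (x ∸ 1)) (#U∩nonzero b)))
    where
    h : ℕ → ℕ
    h _ = 7 * 6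

  shared-line : ∀ {U W} → Block U → Block W → ¬ U ≗V W → U ⊆V S → W ⊆V S →
                ∃ λ T → HasDim T 2 × T ⊆V U × T ⊆V W
  shared-line {U} {W} bU bW U≢W U⊆S W⊆S =
    let T , T-dim2 , T⊆W∩U = line-in-large-subspace (IsSubspace-∩ (Block.subspace bW) (Block.subspace bU)) 2<#W∩U
    in T , T-dim2 , (λ v → proj₂ ∘ ∧-true⁻ ∘ T⊆W∩U v) , (λ v → proj₁ ∘ ∧-true⁻ ∘ T⊆W∩U v)
    where
    #S≡#U+#U : # S ≡ # U + # U
    #S≡#U+#U = trans (#-HasDim S-dim4) (sym (cong₂ _+_ (Block.#U≡8 bU) (Block.#U≡8 bU)))
    #W≡#U : # W ≡ # U
    #W≡#U = trans (Block.#U≡8 bW) (sym (Block.#U≡8 bU))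
    8≤#W∩U+#W∩U : 4 + 4 ≤ # (W ∩V U) + # (W ∩V U)
    8≤#W∩U+#W∩U = subst (_≤ # (W ∩V U) + # (W ∩V U)) (Block.#U≡8 bU)
      (#-∩-index2 (Block.subspace bU) (Block.subspace bW) S-sub U⊆S W⊆S #S≡#U+#U #W≡#U U≢W)
    2<#W∩U : 2 < # (W ∩V U)
    2<#W∩U = ≤-trans (n≤1+n 3) (m+m≤n+n⇒m≤n 8≤#W∩U+#W∩U)

  c₃≤1 : c 3 ≤ 1
  c₃≤1 = AllPairs⇒CountP-≤1
    (AllPairs.map not-both-in-S
      (AllPairs.zip (AllPairs.zip (C-distinct , one-member-per-line) , All⇒AllPairs blocks)))
    CountP-⊆S
    where
    SharesNoLine : SubsetV 7 → SubsetV 7 → Set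
    SharesNoLine U W = ∀ ((T , _) : ∃ λ T → HasDim T 2) → T ⊆V U → ¬ T ⊆V W
    one-member-per-line : AllPairs SharesNoLine C
    one-member-per-line = AllPairs-∀ (λ (T , T-dim2) → CountP-≤1⇒AllPairs (C-lines T T-dim2) ≤-refl)
    not-both-in-S : ∀ {U W} → (¬ U ≗V W × SharesNoLine U W) × (Block U × Block W) → U ⊆V S → ¬ W ⊆V S
    not-both-in-S ((U≢W , no-shared-line) , (bU , bW)) U⊆S W⊆S =
      let T , T-dim2 , T⊆U , T⊆W = shared-line bU bW U≢W U⊆S W⊆S in no-shared-line (T , T-dim2) T⊆U T⊆W

  c₃≡1 : Any (λ U → U ⊆V S) C → c 3 ≡ 1
  c₃≡1 S⊇U = ≤-antisym c₃≤1 (CountP-Any CountP-⊆S S⊇U)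

  c₃≡0 : ¬ Any (λ U → U ⊆V S) C → c 3 ≡ 0
  c₃≡0 S⊉C with c 3 | CountP-⊆S
  ... | zero  | _   = refl
  ... | suc _ | cnt = contradiction (CountP-suc⇒Any cnt) S⊉C

  intersection-vector : ∀ {a₀ a₁ a₂ a₃} → c 0 ≡ a₀ → c 1 ≡ a₁ → c 2 ≡ a₂ → c 3 ≡ a₃ →
      CountP (λ U → HasDim (U ∩V S) 0) C a₀
    × CountP (λ U → HasDim (U ∩V S) 1) C a₁
    × CountP (λ U → HasDim (U ∩V S) 2) C a₂
    × CountP (λ U → HasDim (U ∩V S) 3) C a₃
  intersection-vector refl refl refl refl = CountP-dim 0 , CountP-dim 1 , CountP-dim 2 , CountP-dim 3

solve-with-block : ∀ a b c d → d ≡ 1 → 6 * c + 42 * d ≡ 210 → 6 * b + (18 * c + 42 * d) ≡ 1890 →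
                   42 * a + (42 * b + (42 * c + 42 * d)) ≡ 16002 → a ≡ 128 × b ≡ 224 × c ≡ 28
solve-with-block a b c .1 refl e₁ = solve-b (*+-cancel 6 c 28 42 e₁)
  where
  solve-b : ∀ {c} → c ≡ 28 → 6 * b + (18 * c + 42) ≡ 1890 → 42 * a + (42 * b + (42 * c + 42)) ≡ 16002 →
            a ≡ 128 × b ≡ 224 × c ≡ 28
  solve-b refl e₂ = solve-a (*+-cancel 6 b 224 546 e₂)
    where
    solve-a : ∀ {b} → b ≡ 224 → 42 * a + (42 * b + 1218) ≡ 16002 → a ≡ 128 × b ≡ 224 × 28 ≡ 28
    solve-a refl e₃ = *+-cancel 42 a 128 10626 e₃ , refl , refl

solve-without-block : ∀ a b c d → d ≡ 0 → 6 * c + 42 * d ≡ 210 → 6 * b + (18 * c + 42 * d) ≡ 1890 →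
                      42 * a + (42 * b + (42 * c + 42 * d)) ≡ 16002 → a ≡ 136 × b ≡ 210 × c ≡ 35
solve-without-block a b c .0 refl e₁ = solve-b (*+-cancel 6 c 35 0 e₁)
  where
  solve-b : ∀ {c} → c ≡ 35 → 6 * b + (18 * c + 0) ≡ 1890 → 42 * a + (42 * b + (42 * c + 0)) ≡ 16002 →
            a ≡ 136 × b ≡ 210 × c ≡ 35
  solve-b refl e₂ = solve-a (*+-cancel 6 b 210 630 e₂)
    where
    solve-a : ∀ {b} → b ≡ 210 → 42 * a + (42 * b + 1470) ≡ 16002 → a ≡ 136 × b ≡ 210 × 35 ≡ 35
    solve-a refl e₃ = *+-cancel 42 a 136 10290 e₃ , refl , refl

mainTheorem1 : (C : List (SubsetV 7))
    → AllPairs (λ U W → ¬ (U ≗V W)) C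
    → All (λ U → HasDim U 3) C
    → (∀ T → HasDim T 2 → CountP (λ U → T ⊆V U) C 1)
    → (S : SubsetV 7) → HasDim S 4
    → (Any (λ U → U ⊆V S) C
         → CountP (λ U → HasDim (U ∩V S) 0) C 128
         × CountP (λ U → HasDim (U ∩V S) 1) C 224
         × CountP (λ U → HasDim (U ∩V S) 2) C 28
         × CountP (λ U → HasDim (U ∩V S) 3) C 1)
      × (¬ Any (λ U → U ⊆V S) C
         → CountP (λ U → HasDim (U ∩V S) 0) C 136
         × CountP (λ U → HasDim (U ∩V S) 1) C 210
         × CountP (λ U → HasDim (U ∩V S) 2) C 35
         × CountP (λ U → HasDim (U ∩V S) 3) C 0)
mainTheorem1 C C-distinct C-dim3 C-lines S S-dim4 =
    (λ S⊇U → let a₀ , a₁ , a₂ = solve-with-block _ _ _ _ (c₃≡1 S⊇U) pairs-in-S pairs-from-S all-pairs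
             in intersection-vector a₀ a₁ a₂ (c₃≡1 S⊇U))
  , (λ S⊉C → let a₀ , a₁ , a₂ = solve-without-block _ _ _ _ (c₃≡0 S⊉C) pairs-in-S pairs-from-S all-pairs
             in intersection-vector a₀ a₁ a₂ (c₃≡0 S⊉C))
  where open IntersectionVector C C-distinct C-dim3 C-lines S S-dim4
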